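{- Let $\tilde\alpha\in\{0,1\}^n$ and let $\alpha_k=1$. Then $\alpha_k$ is bound in $\tilde\alpha$ if and only if there exists a $0$-dominated segment of $\tilde\alpha$ preceding $\alpha_k$.
   Context: Indices are cyclic modulo $n$. For $i,j\in\{1,\dots,n\}$ the segment $\tilde\alpha[i:j]$ is $(\alpha_i,\dots,\alpha_j)$ if $i\le j$ and $(\alpha_i,\dots,\alpha_n,\alpha_1,\dots,\alpha_j)$ if $i>j$ (traversed cyclically from $i$ to $j$). Its prefixes are the segments $\tilde\alpha[i:j']$ with $j'$ strictly before $j$ in this cyclic traversal starting at $i$; its suffixes are $\tilde\alpha[i':j]$ with $i'$ strictly after $i$. A segment is balanced / $0$-dominated / $1$-dominated if its number of zeros is equal to / greater than / less than its number of ones. A minimal balanced segment is a balanced segment every prefix of which is $0$-dominated. A component $\alpha_i=0$ and a component $\alpha_j=1$ are connected (to each other) if $\tilde\alpha[i:j]$ is a minimal balanced segment. A component is bound if it is connected to some component, unbound otherwise. A segment $\tilde\alpha[l:m]$ precedes the component $\alpha_{m+1}$ (the component $\alpha_1$ if $m=n$). -}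

module Defs where

open import Data.Bool using (Bool; true; false; not; _∧_)
open import Data.Nat using (ℕ; suc; _<_; _≤ᵇ_)
open import Data.Fin using (Fin; toℕ)
open import Data.List using (List; _++_; map; allFin; filterᵇ; length)
open import Data.List.Membership.Propositional using (_∈_)
open import Data.Product using (Σ; _×_; ∃; ∃-syntax)
open import Data.Sum using (_⊎_)
open import Relation.Binary.PropositionalEquality using (_≡_; _≢_)

-- A word α̃ ∈ {0,1}^n is a function Fin n → Bool; component 0 is `false`,
-- component 1 is `true`. Positions are 0-based (Fin n), so position p
-- corresponds to the paper's index p+1.

module _ {n : ℕ} (α : Fin n → Bool) where

  segPos : Fin n → Fin n → List (Fin n)
  segPos i j with toℕ i ≤ᵇ toℕ j
  ... | true  = filterᵇ (λ x → (toℕ i ≤ᵇ toℕ x) ∧ (toℕ x ≤ᵇ toℕ j)) (allFin n)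
  ... | false = filterᵇ (λ x → toℕ i ≤ᵇ toℕ x) (allFin n)
                ++ filterᵇ (λ x → toℕ x ≤ᵇ toℕ j) (allFin n)

  seg : Fin n → Fin n → List Bool
  seg i j = map α (segPos i j)

  zeros : List Bool → ℕ
  zeros xs = length (filterᵇ not xs)

  ones : List Bool → ℕ
  ones xs = length (filterᵇ (λ b → b) xs)

  Balanced : Fin n → Fin n → Set
  Balanced i j = zeros (seg i j) ≡ ones (seg i j)

  ZeroDominated : Fin n → Fin n → Set
  ZeroDominated i j = ones (seg i j) < zeros (seg i j)

  OneDominated : Fin n → Fin n → Set
  OneDominated i j = zeros (seg i j) < ones (seg i j)

  -- prefixes of α̃[i:j] are α̃[i:j'] with j' strictly before j in the
  -- cyclic traversal starting at i, i.e. j' a position of the segment, j' ≠ j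
  MinimalBalanced : Fin n → Fin n → Set
  MinimalBalanced i j =
    Balanced i j × (∀ j' → j' ∈ segPos i j → j' ≢ j → ZeroDominated i j')

  ConnectedZO : Fin n → Fin n → Set
  ConnectedZO i j = α i ≡ false × α j ≡ true × MinimalBalanced i j

  Connected : Fin n → Fin n → Set
  Connected a b = ConnectedZO a b ⊎ ConnectedZO b a

  Bound : Fin n → Set
  Bound a = ∃[ b ] Connected a b

  -- α̃[l:m] precedes α_k : k = m+1 cyclically (k is the first position if m is the last)
  PrecedesPos : Fin n → Fin n → Set
  PrecedesPos m k = toℕ k ≡ suc (toℕ m) ⊎ (toℕ k ≡ 0 × suc (toℕ m) ≡ n)

module Submission where

-- Unroll the cyclic word to the N-periodic sequence A on ℕ.  A segment of
-- the cyclic word starting at i is then a window [i, i + d] of A, where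
-- d = dist i j is the cyclic distance from i to j, and its positions are
-- exactly the positions at cyclic distance ≤ d from i.
--
-- (⇒) If α k is connected to the 0 at b, the segment from b to the
--     predecessor m of k is a proper prefix of the minimal balanced segment
--     from b to k, hence 0-dominated, and it precedes k.
-- (⇐) A 0-dominated segment preceding k is the word of the last L letters
--     before k.  Reading these words backwards from k, a first-passage
--     argument finds the first t at which they become 0-dominated; the 0
--     reached at that moment is connected to α k: the segment from it to k
--     is balanced, and each proper prefix is 0-dominated because the
--     complementary suffix is a shorter word that is not 0-dominated.

open import Data.Bool using (Bool; true; false; not; _∧_; T)
open import Data.Bool.Properties using (T-∧)
open import Data.Nat using (ℕ; zero; suc; _+_; _*_; _∸_; _≤_; _<_; _≤ᵇ_; z≤n; s≤s; z<s; s<s; s≤s⁻¹; NonZero)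
open import Data.Nat.Properties
open import Data.Nat.DivMod using (_%_; _mod_; m%n<n; m%n%n≡m%n; [m+n]%n≡m%n; [m+kn]%n≡m%n; m<n⇒m%n≡m; n%n≡0; %-distribˡ-+)
open import Data.Fin as Fin using (Fin; toℕ; fromℕ; inject₁)
open import Data.Fin.Properties using (toℕ-injective; toℕ<n; toℕ-fromℕ; toℕ-fromℕ<; toℕ-inject₁)
open import Data.List using (List; []; _∷_; _++_; map; allFin; filterᵇ; tabulate; length)
open import Data.List.Properties using (map-++; map-∘; map-cong; map-injective; map-tabulate; tabulate-cong; filter-all; filter-none; filter-++; length-++; ++-identityʳ)
open import Data.List.Relation.Unary.All using (All; []; _∷_)
open import Data.List.Relation.Unary.Any using (here; there)
open import Data.List.Membership.Propositional using (_∈_)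
open import Data.List.Membership.Propositional.Properties using (∈-map⁺; ∈-map⁻)
open import Data.Product using (_×_; _,_; proj₁; proj₂; ∃-syntax)
open import Data.Sum using (_⊎_; inj₁; inj₂)
open import Function using (_∘_)
open import Function.Bundles using (_⇔_; mk⇔; Equivalence)
open import Relation.Nullary using (¬_; yes; no; contradiction)
open import Relation.Nullary.Decidable using (T?)
open import Relation.Binary.PropositionalEquality using (_≡_; _≢_; refl; sym; trans; cong; cong₂; subst; subst₂; module ≡-Reasoning)

open import Defs

interval : ℕ → ℕ → List ℕ
interval a zero    = []
interval a (suc c) = a ∷ interval (suc a) c

interval-++ : ∀ a c d → interval a (c + d) ≡ interval a c ++ interval (a + c) d
interval-++ a zero    d = cong (λ x → interval x d) (sym (+-identityʳ a))
interval-++ a (suc c) d =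
  cong (a ∷_) (trans (interval-++ (suc a) c d) (cong (λ x → interval (suc a) c ++ interval x d) (sym (+-suc a c))))

∈-interval⁺ : ∀ {a c d} → d < c → a + d ∈ interval a c
∈-interval⁺ {a} {suc c} {zero}  _         = here (+-identityʳ a)
∈-interval⁺ {a} {suc c} {suc d} (s<s d<c) = there (subst (_∈ interval (suc a) c) (sym (+-suc a d)) (∈-interval⁺ d<c))

∈-interval⁻ : ∀ {a c x} → x ∈ interval a c → ∃[ d ] (d < c × x ≡ a + d)
∈-interval⁻ {a} {suc c} (here x≡a) = 0 , z<s , trans x≡a (sym (+-identityʳ a))
∈-interval⁻ {a} {suc c} (there x∈) with d , d<c , x≡ ← ∈-interval⁻ x∈ =
  suc d , s<s d<c , trans x≡ (sym (+-suc a d))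

all-interval : ∀ {P : ℕ → Set} a c → (∀ d → d < c → P (a + d)) → All P (interval a c)
all-interval a zero    _ = []
all-interval {P} a (suc c) h =
  subst P (+-identityʳ a) (h 0 z<s) ∷ all-interval (suc a) c (λ d d<c → subst P (+-suc a d) (h (suc d) (s<s d<c)))

allFin-interval : ∀ n → map toℕ (allFin n) ≡ interval 0 n
allFin-interval n = trans (map-tabulate (λ x → x) toℕ) (tabulate-interval 0 n)
  where
    tabulate-interval : ∀ a m → tabulate {n = m} (λ x → a + toℕ x) ≡ interval a m
    tabulate-interval a zero    = refl
    tabulate-interval a (suc m) =
      cong₂ _∷_ (+-identityʳ a) (trans (tabulate-cong (λ x → +-suc a (toℕ x))) (tabulate-interval (suc a) m))

filter-interval : ∀ (q : ℕ → Bool) {a b n} → a ≤ b → b ≤ n →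
                  (∀ {x} → x < n → T (q x) ⇔ (a ≤ x × x < b)) →
                  filterᵇ q (interval 0 n) ≡ interval a (b ∸ a)
filter-interval q {a} {b} {n} a≤b b≤n spec = begin
    filterᵇ q (interval 0 n)
  ≡⟨ cong (filterᵇ q) three-parts ⟩
    filterᵇ q (interval 0 a ++ interval a (b ∸ a) ++ interval b (n ∸ b))
  ≡⟨ filter-++ (T? ∘ q) (interval 0 a) _ ⟩
    filterᵇ q (interval 0 a) ++ filterᵇ q (interval a (b ∸ a) ++ interval b (n ∸ b))
  ≡⟨ cong₂ _++_ (filter-none (T? ∘ q) below) (filter-++ (T? ∘ q) (interval a (b ∸ a)) _) ⟩
    filterᵇ q (interval a (b ∸ a)) ++ filterᵇ q (interval b (n ∸ b))
  ≡⟨ cong₂ _++_ (filter-all (T? ∘ q) inside) (filter-none (T? ∘ q) above) ⟩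
    interval a (b ∸ a) ++ []
  ≡⟨ ++-identityʳ _ ⟩
    interval a (b ∸ a) ∎
  where
    open ≡-Reasoning
    a+[b∸a] : a + (b ∸ a) ≡ b
    a+[b∸a] = m+[n∸m]≡n a≤b
    three-parts : interval 0 n ≡ interval 0 a ++ interval a (b ∸ a) ++ interval b (n ∸ b)
    three-parts = begin
        interval 0 n
      ≡⟨ cong (interval 0) (sym (trans (sym (+-assoc a (b ∸ a) (n ∸ b)))
                                       (trans (cong (_+ (n ∸ b)) a+[b∸a]) (m+[n∸m]≡n b≤n)))) ⟩
        interval 0 (a + ((b ∸ a) + (n ∸ b)))
      ≡⟨ interval-++ 0 a _ ⟩
        interval 0 a ++ interval a ((b ∸ a) + (n ∸ b))
      ≡⟨ cong (interval 0 a ++_) (interval-++ a (b ∸ a) (n ∸ b)) ⟩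
        interval 0 a ++ interval a (b ∸ a) ++ interval (a + (b ∸ a)) (n ∸ b)
      ≡⟨ cong (λ x → interval 0 a ++ interval a (b ∸ a) ++ interval x (n ∸ b)) a+[b∸a] ⟩
        interval 0 a ++ interval a (b ∸ a) ++ interval b (n ∸ b) ∎
    below : All (λ x → ¬ T (q x)) (interval 0 a)
    below = all-interval 0 a λ d d<a qd →
      <⇒≱ d<a (proj₁ (Equivalence.to (spec (<-≤-trans d<a (≤-trans a≤b b≤n))) qd))
    inside : All (T ∘ q) (interval a (b ∸ a))
    inside = all-interval a (b ∸ a) λ d d<b∸a →
      let a+d<b = subst (a + d <_) a+[b∸a] (+-monoʳ-< a d<b∸a)
      in Equivalence.from (spec (<-≤-trans a+d<b b≤n)) (m≤m+n a d , a+d<b)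
    above : All (λ x → ¬ T (q x)) (interval b (n ∸ b))
    above = all-interval b (n ∸ b) λ d d<n∸b qd →
      let b+d<n = subst (b + d <_) (m+[n∸m]≡n b≤n) (+-monoʳ-< b d<n∸b)
      in <⇒≱ (proj₂ (Equivalence.to (spec b+d<n) qd)) (m≤m+n b d)

map-filterᵇ : ∀ {A : Set} (f : A → ℕ) (q : ℕ → Bool) xs →
              map f (filterᵇ (q ∘ f) xs) ≡ filterᵇ q (map f xs)
map-filterᵇ f q []       = refl
map-filterᵇ f q (x ∷ xs) with q (f x)
... | true  = cong (f x ∷_) (map-filterᵇ f q xs)
... | false = map-filterᵇ f q xs

-- The numbers of 0s and 1s in a word.  They are definitionally the counts
-- zeros α and ones α of Defs, which do not use their parameter α.
#0 #1 : List Bool → ℕ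
#0 xs = length (filterᵇ not xs)
#1 xs = length (filterᵇ (λ b → b) xs)

#0-++ : ∀ xs ys → #0 (xs ++ ys) ≡ #0 xs + #0 ys
#0-++ xs ys = trans (cong length (filter-++ (T? ∘ not) xs ys)) (length-++ (filterᵇ not xs))

#1-++ : ∀ xs ys → #1 (xs ++ ys) ≡ #1 xs + #1 ys
#1-++ xs ys = trans (cong length (filter-++ (T? ∘ (λ b → b)) xs ys)) (length-++ (filterᵇ (λ b → b) xs))

balance-with-one : ∀ xs → #0 xs ≡ suc (#1 xs) → #0 (xs ++ true ∷ []) ≡ #1 (xs ++ true ∷ [])
balance-with-one xs surplus = begin
  #0 (xs ++ true ∷ []) ≡⟨ #0-++ xs _ ⟩
  #0 xs + 0            ≡⟨ +-identityʳ _ ⟩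
  #0 xs                ≡⟨ surplus ⟩
  suc (#1 xs)          ≡⟨ +-comm 1 _ ⟩
  #1 xs + 1            ≡⟨ sym (#1-++ xs _) ⟩
  #1 (xs ++ true ∷ []) ∎
  where open ≡-Reasoning

prefix-dominated : ∀ xs ys → #0 (xs ++ ys) ≡ suc (#1 (xs ++ ys)) → #0 ys ≤ #1 ys → #1 xs < #0 xs
prefix-dominated xs ys surplus ys-not-dominated = ≰⇒> λ xs-not-dominated → 1+n≰n (begin
  suc (#1 xs + #1 ys)   ≡⟨ cong suc (sym (#1-++ xs ys)) ⟩
  suc (#1 (xs ++ ys))   ≡⟨ sym surplus ⟩
  #0 (xs ++ ys)         ≡⟨ #0-++ xs ys ⟩
  #0 xs + #0 ys         ≤⟨ +-mono-≤ xs-not-dominated ys-not-dominated ⟩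
  #1 xs + #1 ys         ∎)
  where open ≤-Reasoning

-- W 0, W 1, … are words with W 0 empty, each obtained from the previous
-- one by adding the letter c s in front.  The first passage of their
-- balance into 0-domination happens at step t when a 0 is added to a
-- balanced word, no earlier word being 0-dominated.
FirstExcess : (ℕ → Bool) → (ℕ → List Bool) → ℕ → Set
FirstExcess c W L = ∃[ t ] (t < L × c t ≡ false × #0 (W t) ≡ #1 (W t) ×
                           (∀ u → u ≤ t → #0 (W u) ≤ #1 (W u)))

≤-extend : ∀ {P : ℕ → Set} {L} → (∀ u → u ≤ L → P u) → P (suc L) → ∀ u → u ≤ suc L → P u
≤-extend below top u u≤ with m≤n⇒m<n∨m≡n u≤
... | inj₁ u<   = below u (s≤s⁻¹ u<)
... | inj₂ refl = top

never-or-first-excess : ∀ (c : ℕ → Bool) (W : ℕ → List Bool) L → W 0 ≡ [] →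
                        (∀ s → s < L → W (suc s) ≡ c s ∷ W s) →
                        (∀ u → u ≤ L → #0 (W u) ≤ #1 (W u)) ⊎ FirstExcess c W L
never-or-first-excess c W zero W0 grow =
  inj₁ λ { zero _ → subst (λ w → #0 w ≤ #1 w) (sym W0) z≤n ; (suc _) () }
never-or-first-excess c W (suc L) W0 grow
  with never-or-first-excess c W L W0 (λ s s<L → grow s (m<n⇒m<1+n s<L))
... | inj₂ (t , t<L , found) = inj₂ (t , m<n⇒m<1+n t<L , found)
... | inj₁ never with c L in cL | grow L (n<1+n L) | #0 (W L) ≟ #1 (W L)
...   | false | _    | yes balanced  = inj₂ (L , n<1+n L , cL , balanced , never)
...   | false | step | no unbalanced =
  inj₁ (≤-extend never (subst (λ w → #0 w ≤ #1 w) (sym step) (≤∧≢⇒< (never L ≤-refl) unbalanced)))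
...   | true  | step | _             =
  inj₁ (≤-extend never (subst (λ w → #0 w ≤ #1 w) (sym step) (m≤n⇒m≤1+n (never L ≤-refl))))

first-excess : ∀ (c : ℕ → Bool) (W : ℕ → List Bool) L → W 0 ≡ [] →
               (∀ s → s < L → W (suc s) ≡ c s ∷ W s) →
               #1 (W L) < #0 (W L) → FirstExcess c W L
first-excess c W L W0 grow dominated with never-or-first-excess c W L W0 grow
... | inj₁ never = contradiction (never L ≤-refl) (<⇒≱ dominated)
... | inj₂ found = found

module Congruence (N : ℕ) .{{_ : NonZero N}} where

  infix 4 _≡ₘ_
  _≡ₘ_ : ℕ → ℕ → Set
  a ≡ₘ b = a % N ≡ b % N

  period : ∀ a → a + N ≡ₘ a
  period a = [m+n]%n≡m%n a N

  +-congˡ : ∀ c {a b} → a ≡ₘ b → c + a ≡ₘ c + b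
  +-congˡ c {a} {b} a≡b = begin
    (c + a) % N         ≡⟨ %-distribˡ-+ c a N ⟩
    (c % N + a % N) % N ≡⟨ cong (λ r → (c % N + r) % N) a≡b ⟩
    (c % N + b % N) % N ≡⟨ sym (%-distribˡ-+ c b N) ⟩
    (c + b) % N         ∎
    where open ≡-Reasoning

  +-congʳ : ∀ c {a b} → a ≡ₘ b → a + c ≡ₘ b + c
  +-congʳ c {a} {b} a≡b = subst₂ _≡ₘ_ (+-comm c a) (+-comm c b) (+-congˡ c a≡b)

  -- Adding c can be undone by adding c * N − c, a multiple of N minus c.
  +-cancelˡ : ∀ c {a b} → c + a ≡ₘ c + b → a ≡ₘ b
  +-cancelˡ c {a} {b} e = trans (sym (undo a)) (trans (+-congˡ r e) (undo b))
    where
      r = c * N ∸ c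
      undo : ∀ x → r + (c + x) ≡ₘ x
      undo x = trans (cong (_% N) r+c+x) ([m+kn]%n≡m%n x c N)
        where r+c+x : r + (c + x) ≡ x + c * N
              r+c+x = trans (sym (+-assoc r c x)) (trans (cong (_+ x) (m∸n+n≡m (m≤m*n c N))) (+-comm (c * N) x))

  +-cancelʳ : ∀ c {a b} → a + c ≡ₘ b + c → a ≡ₘ b
  +-cancelʳ c {a} {b} e = +-cancelˡ c (subst₂ _≡ₘ_ (+-comm a c) (+-comm b c) e)

  residue-unique : ∀ {a b} → a < N → b < N → a ≡ₘ b → a ≡ b
  residue-unique a<N b<N e = trans (sym (m<n⇒m%n≡m a<N)) (trans e (m<n⇒m%n≡m b<N))

  interval-cong : ∀ {X : Set} (f : ℕ → X) → (∀ {a b} → a ≡ₘ b → f a ≡ f b) →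
                  ∀ {a b} c → a ≡ₘ b → map f (interval a c) ≡ map f (interval b c)
  interval-cong f resp zero    e = refl
  interval-cong f resp (suc c) e = cong₂ _∷_ (resp e) (interval-cong f resp c (+-congˡ 1 e))

  interval-residues : ∀ a c → a + c ≤ N → map (_% N) (interval a c) ≡ interval a c
  interval-residues a zero    _   = refl
  interval-residues a (suc c) a+c≤N =
    cong₂ _∷_ (m<n⇒m%n≡m (<-≤-trans (m<m+n a z<s) a+c≤N))
              (interval-residues (suc a) c (subst (_≤ N) (+-suc a c) a+c≤N))

module Cyclic {n′ : ℕ} (α : Fin (suc n′) → Bool) where

  N : ℕ
  N = suc n′

  open Congruence N public

  toℕ-mod : ∀ p → toℕ (p mod N) ≡ₘ p
  toℕ-mod p = trans (cong (_% N) (toℕ-fromℕ< (m%n<n p N))) (m%n%n≡m%n p N)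

  mod-cong : ∀ {a b} → a ≡ₘ b → a mod N ≡ b mod N
  mod-cong {a} {b} e = toℕ-injective (trans (toℕ-fromℕ< (m%n<n a N)) (trans e (sym (toℕ-fromℕ< (m%n<n b N)))))

  mod-over : ∀ p (x : Fin N) → p ≡ₘ toℕ x → p mod N ≡ x
  mod-over p x e =
    toℕ-injective (trans (toℕ-fromℕ< (m%n<n p N)) (trans e (m<n⇒m%n≡m (toℕ<n x))))

  A : ℕ → Bool
  A p = α (p mod N)

  A-cong : ∀ {a b} → a ≡ₘ b → A a ≡ A b
  A-cong {a} {b} e = cong α (mod-cong {a} {b} e)

  A-toℕ : ∀ x → A (toℕ x) ≡ α x
  A-toℕ x = cong α (mod-over (toℕ x) x refl)

  window : ℕ → ℕ → List Bool
  window a c = map A (interval a c)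

  window-++ : ∀ a c d → window a (c + d) ≡ window a c ++ window (a + c) d
  window-++ a c d = trans (cong (map A) (interval-++ a c d)) (map-++ A (interval a c) _)

  window-cong : ∀ {a b} c → a ≡ₘ b → window a c ≡ window b c
  window-cong = interval-cong A (λ {a} {b} → A-cong {a} {b})

  dist : Fin N → Fin N → ℕ
  dist i j = (toℕ j + N ∸ toℕ i) % N

  dist<N : ∀ i j → dist i j < N
  dist<N i j = m%n<n (toℕ j + N ∸ toℕ i) N

  dist-over : ∀ i j → toℕ i + dist i j ≡ₘ toℕ j
  dist-over i j = begin
      (toℕ i + x % N) % N ≡⟨ +-congˡ (toℕ i) (m%n%n≡m%n x N) ⟩
      (toℕ i + x) % N     ≡⟨ cong (_% N) (m+[n∸m]≡n (≤-trans (<⇒≤ (toℕ<n i)) (m≤n+m N (toℕ j)))) ⟩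
      (toℕ j + N) % N     ≡⟨ period (toℕ j) ⟩
      toℕ j % N           ∎
    where open ≡-Reasoning
          x = toℕ j + N ∸ toℕ i

  dist-unique : ∀ i j {d} → d < N → toℕ i + d ≡ₘ toℕ j → dist i j ≡ d
  dist-unique i j d<N e = residue-unique (dist<N i j) d<N (+-cancelˡ (toℕ i) (trans (dist-over i j) (sym e)))

  dist-injective : ∀ i j j′ → dist i j ≡ dist i j′ → j ≡ j′
  dist-injective i j j′ e = toℕ-injective (residue-unique (toℕ<n j) (toℕ<n j′)
    (trans (sym (dist-over i j)) (trans (cong (λ d → (toℕ i + d) % N) e) (dist-over i j′))))

  dist-self : ∀ i → dist i i ≡ 0
  dist-self i = dist-unique i i z<s (cong (_% N) (+-identityʳ (toℕ i)))

  filter-positions : ∀ q → map toℕ (filterᵇ (q ∘ toℕ) (allFin N)) ≡ filterᵇ q (interval 0 N)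
  filter-positions q = trans (map-filterᵇ toℕ q (allFin N)) (cong (filterᵇ q) (allFin-interval N))

  positions-≤ : ∀ i j → toℕ i ≤ toℕ j →
                map toℕ (filterᵇ (λ x → (toℕ i ≤ᵇ toℕ x) ∧ (toℕ x ≤ᵇ toℕ j)) (allFin N))
                  ≡ map (_% N) (interval (toℕ i) (suc (dist i j)))
  positions-≤ i j I≤J = begin
      map toℕ (filterᵇ (q ∘ toℕ) (allFin N))
    ≡⟨ filter-positions q ⟩
      filterᵇ q (interval 0 N)
    ≡⟨ filter-interval q (≤-trans I≤J (n≤1+n J)) (toℕ<n j) spec ⟩
      interval I (suc J ∸ I)
    ≡⟨ cong (interval I) (+-∸-assoc 1 I≤J) ⟩
      interval I (suc (J ∸ I))
    ≡⟨ sym (interval-residues I (suc (J ∸ I)) (subst (_≤ N) (sym I+[1+J∸I]) (toℕ<n j))) ⟩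
      map (_% N) (interval I (suc (J ∸ I)))
    ≡⟨ cong (λ d → map (_% N) (interval I (suc d))) (sym dist≡) ⟩
      map (_% N) (interval I (suc (dist i j))) ∎
    where
      open ≡-Reasoning
      I = toℕ i
      J = toℕ j
      q : ℕ → Bool
      q y = (I ≤ᵇ y) ∧ (y ≤ᵇ J)
      spec : ∀ {y} → y < N → T (q y) ⇔ (I ≤ y × y < suc J)
      spec _ = mk⇔ (λ t → let (p , r) = Equivalence.to T-∧ t in ≤ᵇ⇒≤ _ _ p , s≤s (≤ᵇ⇒≤ _ _ r))
                   (λ (p , r) → Equivalence.from T-∧ (≤⇒≤ᵇ p , ≤⇒≤ᵇ (s≤s⁻¹ r)))
      I+[1+J∸I] : I + suc (J ∸ I) ≡ suc J
      I+[1+J∸I] = trans (+-suc I (J ∸ I)) (cong suc (m+[n∸m]≡n I≤J))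
      dist≡ : dist i j ≡ J ∸ I
      dist≡ = dist-unique i j (≤-<-trans (m∸n≤m J I) (toℕ<n j)) (cong (_% N) (m+[n∸m]≡n I≤J))

  positions-> : ∀ i j → toℕ j < toℕ i →
                map toℕ (filterᵇ (λ x → toℕ i ≤ᵇ toℕ x) (allFin N) ++ filterᵇ (λ x → toℕ x ≤ᵇ toℕ j) (allFin N))
                  ≡ map (_% N) (interval (toℕ i) (suc (dist i j)))
  positions-> i j J<I = begin
      map toℕ (filterᵇ ((I ≤ᵇ_) ∘ toℕ) (allFin N) ++ filterᵇ ((_≤ᵇ J) ∘ toℕ) (allFin N))
    ≡⟨ map-++ toℕ (filterᵇ ((I ≤ᵇ_) ∘ toℕ) (allFin N)) _ ⟩
      map toℕ (filterᵇ ((I ≤ᵇ_) ∘ toℕ) (allFin N)) ++ map toℕ (filterᵇ ((_≤ᵇ J) ∘ toℕ) (allFin N))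
    ≡⟨ cong₂ _++_ (trans (filter-positions (I ≤ᵇ_)) from-I) (trans (filter-positions (_≤ᵇ J)) to-J) ⟩
      interval I (N ∸ I) ++ interval 0 (suc J)
    ≡⟨ cong₂ _++_ (sym (interval-residues I (N ∸ I) (≤-reflexive I+[N∸I])))
                  (sym (trans (interval-cong (_% N) (λ e → e) (suc J) (n%n≡0 N)) (interval-residues 0 (suc J) (toℕ<n j)))) ⟩
      map (_% N) (interval I (N ∸ I)) ++ map (_% N) (interval N (suc J))
    ≡⟨ sym (map-++ (_% N) (interval I (N ∸ I)) _) ⟩
      map (_% N) (interval I (N ∸ I) ++ interval N (suc J))
    ≡⟨ cong (λ x → map (_% N) (interval I (N ∸ I) ++ interval x (suc J))) (sym I+[N∸I]) ⟩
      map (_% N) (interval I (N ∸ I) ++ interval (I + (N ∸ I)) (suc J))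
    ≡⟨ cong (map (_% N)) (sym (interval-++ I (N ∸ I) (suc J))) ⟩
      map (_% N) (interval I (N ∸ I + suc J))
    ≡⟨ cong (λ d → map (_% N) (interval I d)) (trans (+-suc (N ∸ I) J) (cong suc (sym dist≡))) ⟩
      map (_% N) (interval I (suc (dist i j))) ∎
    where
      open ≡-Reasoning
      I = toℕ i
      J = toℕ j
      I+[N∸I] : I + (N ∸ I) ≡ N
      I+[N∸I] = m+[n∸m]≡n (<⇒≤ (toℕ<n i))
      from-I : filterᵇ (I ≤ᵇ_) (interval 0 N) ≡ interval I (N ∸ I)
      from-I = filter-interval (I ≤ᵇ_) (<⇒≤ (toℕ<n i)) ≤-refl
                 (λ y<N → mk⇔ (λ t → ≤ᵇ⇒≤ _ _ t , y<N) (≤⇒≤ᵇ ∘ proj₁))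
      to-J : filterᵇ (_≤ᵇ J) (interval 0 N) ≡ interval 0 (suc J)
      to-J = filter-interval (_≤ᵇ J) z≤n (toℕ<n j)
               (λ _ → mk⇔ (λ t → z≤n , s≤s (≤ᵇ⇒≤ _ _ t)) (≤⇒≤ᵇ ∘ s≤s⁻¹ ∘ proj₂))
      dist≡ : dist i j ≡ N ∸ I + J
      dist≡ = dist-unique i j (subst (N ∸ I + J <_) (m∸n+n≡m (<⇒≤ (toℕ<n i))) (+-monoʳ-< (N ∸ I) J<I))
                (trans (cong (_% N) (trans (sym (+-assoc I (N ∸ I) J)) (trans (cong (_+ J) I+[N∸I]) (+-comm N J))))
                       (period J))

  segPos-toℕ : ∀ i j → map toℕ (segPos α i j) ≡ map (_% N) (interval (toℕ i) (suc (dist i j)))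
  segPos-toℕ i j with toℕ i ≤ᵇ toℕ j in eq
  ... | true  = positions-≤ i j (≤ᵇ⇒≤ (toℕ i) (toℕ j) (subst T (sym eq) _))
  ... | false = positions-> i j (≰⇒> (λ I≤J → subst T eq (≤⇒≤ᵇ I≤J)))

  segPos-interval : ∀ i j → segPos α i j ≡ map (_mod N) (interval (toℕ i) (suc (dist i j)))
  segPos-interval i j = map-injective toℕ-injective (trans (segPos-toℕ i j) (sym toℕ-∘-mod))
    where
      xs = interval (toℕ i) (suc (dist i j))
      toℕ-∘-mod : map toℕ (map (_mod N) xs) ≡ map (_% N) xs
      toℕ-∘-mod = trans (sym (map-∘ xs)) (map-cong (λ p → toℕ-fromℕ< (m%n<n p N)) xs)

  seg-window : ∀ i j → seg α i j ≡ window (toℕ i) (suc (dist i j))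
  seg-window i j = trans (cong (map α) (segPos-interval i j)) (sym (map-∘ (interval (toℕ i) (suc (dist i j)))))

  ∈-segPos⁻ : ∀ {i j x} → x ∈ segPos α i j → dist i x ≤ dist i j
  ∈-segPos⁻ {i} {j} {x} x∈ =
    let (p , p∈ , x≡p-mod) = ∈-map⁻ (_mod N) (subst (x ∈_) (segPos-interval i j) x∈)
        (d , d<1+D , p≡i+d) = ∈-interval⁻ p∈
        i+d-over-x : toℕ i + d ≡ₘ toℕ x
        i+d-over-x = subst₂ _≡ₘ_ p≡i+d (cong toℕ (sym x≡p-mod)) (sym (toℕ-mod p))
    in subst (_≤ dist i j) (sym (dist-unique i x (<-≤-trans d<1+D (dist<N i j)) i+d-over-x)) (s≤s⁻¹ d<1+D)

  ∈-segPos⁺ : ∀ {i j x} → dist i x ≤ dist i j → x ∈ segPos α i j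
  ∈-segPos⁺ {i} {j} {x} x-near = subst (x ∈_) (sym (segPos-interval i j))
    (subst (_∈ map (_mod N) (interval (toℕ i) (suc (dist i j)))) (mod-over (toℕ i + dist i x) x (dist-over i x))
           (∈-map⁺ (_mod N) (∈-interval⁺ (s≤s x-near))))

  precedes-over : ∀ {m k} → PrecedesPos α m k → suc (toℕ m) ≡ₘ toℕ k
  precedes-over (inj₁ k≡1+m)         = cong (_% N) (sym k≡1+m)
  precedes-over (inj₂ (k≡0 , 1+m≡N)) = trans (cong (_% N) 1+m≡N) (trans (n%n≡0 N) (cong (_% N) (sym k≡0)))

  predecessor : ∀ k → ∃[ m ] PrecedesPos α m k
  predecessor Fin.zero    = fromℕ n′ , inj₂ (refl , cong suc (toℕ-fromℕ n′))
  predecessor (Fin.suc k) = inject₁ k , inj₁ (cong suc (sym (toℕ-inject₁ k)))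

  predecessor-in-segment : ∀ {b m k} → b ≢ k → PrecedesPos α m k → m ∈ segPos α b k × m ≢ k
  predecessor-in-segment {b} {m} {k} b≢k m→k with dist b k in dist-bk
  ... | zero  = contradiction (sym (dist-injective b k b (trans dist-bk (sym (dist-self b))))) b≢k
  ... | suc d = ∈-segPos⁺ {b} {k} {m} (subst (_≤ dist b k) (sym dist-bm) (subst (d ≤_) (sym dist-bk) (n≤1+n d))) ,
                λ m≡k → 1+n≢n (sym (trans (sym dist-bm) (trans (cong (dist b) m≡k) dist-bk)))
    where
      dist-bm : dist b m ≡ d
      dist-bm = dist-unique b m (<-trans (n<1+n d) (subst (_< N) dist-bk (dist<N b k))) (+-cancelˡ 1 (begin
        suc (toℕ b + d) % N    ≡⟨ cong (_% N) (sym (+-suc (toℕ b) d)) ⟩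
        (toℕ b + suc d) % N    ≡⟨ cong (λ e → (toℕ b + e) % N) (sym dist-bk) ⟩
        (toℕ b + dist b k) % N ≡⟨ dist-over b k ⟩
        toℕ k % N              ≡⟨ sym (precedes-over m→k) ⟩
        suc (toℕ m) % N        ∎))
        where open ≡-Reasoning

  module AtOne (k : Fin N) (αk : α k ≡ true) where

    -- A copy of position k on ℕ with at least N positions before it.
    K : ℕ
    K = toℕ k + N

    N≤K : N ≤ K
    N≤K = m≤n+m N (toℕ k)

    A-K : A K ≡ true
    A-K = trans (A-cong {K} {toℕ k} (period (toℕ k))) (trans (A-toℕ k) αk)

    before : ℕ → List Bool
    before s = window (K ∸ s) s

    letter : ℕ → Bool
    letter s = A (K ∸ suc s)

    before-split : ∀ s u {v} → s + u ≡ v → v ≤ K → before v ≡ window (K ∸ v) s ++ before u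
    before-split s u refl s+u≤K =
      trans (window-++ (K ∸ (s + u)) s u) (cong (λ x → window (K ∸ (s + u)) s ++ window x u) start-of-u)
      where
        start-of-u : K ∸ (s + u) + s ≡ K ∸ u
        start-of-u = trans (cong (_+ s) (trans (cong (K ∸_) (+-comm s u)) (sym (∸-+-assoc K u s))))
                           (m∸n+n≡m (m+n≤o⇒m≤o∸n s s+u≤K))

    before-grow : ∀ s → s < K → before (suc s) ≡ letter s ∷ before s
    before-grow s s<K = before-split 1 s refl s<K

    preceding-segment : ∀ l m → PrecedesPos α m k → seg α l m ≡ before (suc (dist l m))
    preceding-segment l m m→k = trans (seg-window l m) (window-cong L start)
      where
        L = suc (dist l m)
        L≤K : L ≤ K
        L≤K = ≤-trans (dist<N l m) N≤K
        start : toℕ l ≡ₘ K ∸ L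
        start = +-cancelʳ L {toℕ l} {K ∸ L} (begin
          (toℕ l + L) % N          ≡⟨ cong (_% N) (+-suc (toℕ l) (dist l m)) ⟩
          suc (toℕ l + dist l m) % N ≡⟨ +-congˡ 1 {toℕ l + dist l m} {toℕ m} (dist-over l m) ⟩
          suc (toℕ m) % N          ≡⟨ precedes-over m→k ⟩
          toℕ k % N                ≡⟨ sym (period (toℕ k)) ⟩
          K % N                    ≡⟨ cong (_% N) (sym (m∸n+n≡m L≤K)) ⟩
          (K ∸ L + L) % N          ∎)
          where open ≡-Reasoning

    -- The letter N steps before K is α k = 1, so a 0 found by looking back
    -- at most N steps lies strictly less than N steps back.
    zero-within-period : ∀ t → suc t ≤ N → letter t ≡ false → suc t < N
    zero-within-period t r≤N letter≡0 with m≤n⇒m<n∨m≡n r≤N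
    ... | inj₁ r<N = r<N
    ... | inj₂ r≡N = contradiction (trans (sym letter≡0) letter-N) λ ()
      where letter-N : letter t ≡ true
            letter-N = trans (cong (λ x → A (K ∸ x)) r≡N) (trans (cong A (m+n∸n≡m (toℕ k) N)) (trans (A-toℕ k) αk))

    connect : FirstExcess letter before N → Bound α k
    connect (t , r≤N , letter≡0 , balanced , never) = b , inj₂ (letter≡0 , αk , balanced-bk , prefixes)
      where
        r = suc t
        r<N : r < N
        r<N = zero-within-period t r≤N letter≡0
        r≤K : r ≤ K
        r≤K = ≤-trans r≤N N≤K
        b : Fin N
        b = (K ∸ r) mod N
        b-over : toℕ b ≡ₘ K ∸ r
        b-over = toℕ-mod (K ∸ r)
        dist-bk : dist b k ≡ r
        dist-bk = dist-unique b k r<N (begin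
          (toℕ b + r) % N ≡⟨ +-congʳ r {toℕ b} {K ∸ r} b-over ⟩
          (K ∸ r + r) % N ≡⟨ cong (_% N) (m∸n+n≡m r≤K) ⟩
          K % N           ≡⟨ period (toℕ k) ⟩
          toℕ k % N       ∎)
          where open ≡-Reasoning
        from-b : ∀ j → seg α b j ≡ window (K ∸ r) (suc (dist b j))
        from-b j = trans (seg-window b j) (window-cong (suc (dist b j)) b-over)
        surplus : #0 (before r) ≡ suc (#1 (before r))
        surplus = trans (cong #0 grow-r) (trans (cong suc balanced) (cong (suc ∘ #1) (sym grow-r)))
          where grow-r : before r ≡ false ∷ before t
                grow-r = trans (before-grow t r≤K) (cong (_∷ before t) letter≡0)
        whole : seg α b k ≡ before r ++ true ∷ []
        whole = begin
          seg α b k                        ≡⟨ from-b k ⟩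
          window (K ∸ r) (suc (dist b k))  ≡⟨ cong (λ d → window (K ∸ r) (suc d)) dist-bk ⟩
          window (K ∸ r) (suc r)           ≡⟨ cong (window (K ∸ r)) (+-comm 1 r) ⟩
          window (K ∸ r) (r + 1)           ≡⟨ window-++ (K ∸ r) r 1 ⟩
          before r ++ window (K ∸ r + r) 1 ≡⟨ cong (λ x → before r ++ window x 1) (m∸n+n≡m r≤K) ⟩
          before r ++ A K ∷ []             ≡⟨ cong (λ x → before r ++ x ∷ []) A-K ⟩
          before r ++ true ∷ []            ∎
          where open ≡-Reasoning
        balanced-bk : Balanced α b k
        balanced-bk = subst (λ w → #0 w ≡ #1 w) (sym whole) (balance-with-one (before r) surplus)
        -- A proper prefix ends s < r steps after b; the rest of the r letters
        -- before k is the word of the last u = t − s letters, not 0-dominated.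
        prefixes : ∀ j → j ∈ segPos α b k → j ≢ k → ZeroDominated α b j
        prefixes j j∈ j≢k = subst (λ w → #1 w < #0 w) (sym (from-b j))
            (prefix-dominated (window (K ∸ r) (suc s)) (before u)
                              (subst (λ w → #0 w ≡ suc (#1 w)) split surplus) (never u (m∸n≤m t s)))
          where
            s = dist b j
            s<r : s < r
            s<r = ≤∧≢⇒< (subst (s ≤_) dist-bk (∈-segPos⁻ {b} {k} {j} j∈))
                        (λ s≡r → j≢k (dist-injective b j k (trans s≡r (sym dist-bk))))
            u = t ∸ s
            split : before r ≡ window (K ∸ r) (suc s) ++ before u
            split = before-split (suc s) u (cong suc (m+[n∸m]≡n (s≤s⁻¹ s<r))) r≤K

    bound⇒dominated : Bound α k → ∃[ l ] ∃[ m ] (ZeroDominated α l m × PrecedesPos α m k)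
    bound⇒dominated (_ , inj₁ (αk≡0 , _)) = contradiction (trans (sym αk) αk≡0) λ ()
    bound⇒dominated (b , inj₂ (αb≡0 , _ , _ , prefixes)) =
      let (m , m→k)   = predecessor k
          (m∈ , m≢k) = predecessor-in-segment b≢k m→k
      in b , m , prefixes m m∈ m≢k , m→k
      where
        b≢k : b ≢ k
        b≢k refl = contradiction (trans (sym αk) αb≡0) λ ()

    dominated⇒bound : ∃[ l ] ∃[ m ] (ZeroDominated α l m × PrecedesPos α m k) → Bound α k
    dominated⇒bound (l , m , dominated , m→k) =
      let (t , t<L , found) = first-excess letter before L refl grow dominated-before
      in connect (t , ≤-trans t<L L≤N , found)
      where
        L = suc (dist l m)
        L≤N : L ≤ N
        L≤N = dist<N l m
        grow : ∀ s → s < L → before (suc s) ≡ letter s ∷ before s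
        grow s s<L = before-grow s (<-≤-trans s<L (≤-trans L≤N N≤K))
        dominated-before : #1 (before L) < #0 (before L)
        dominated-before = subst (λ w → #1 w < #0 w) (preceding-segment l m m→k) dominated

lemma1 : (n : ℕ) (α : Fin n → Bool) (k : Fin n) → α k ≡ true →
    Bound α k ⇔ (∃[ l ] ∃[ m ] (ZeroDominated α l m × PrecedesPos α m k))
lemma1 zero    α ()
lemma1 (suc n′) α k αk = mk⇔ bound⇒dominated dominated⇒bound
  where open Cyclic α
        open AtOne k αk
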